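{- Let $G$ be a graph in $\varepsilon_1$ with $q$ edges, and let $\xi_1$ be the number of cycles in a decomposition of the edge set of $G$ into edge-disjoint cycles. Then $q\equiv \xi_1 \pmod 4$.
   Context: All graphs are finite, simple, undirected and connected. An Euler graph is a connected graph in which every vertex has even degree. $\varepsilon_1$ denotes the class of Euler graphs $G$ such that every cycle of $G$ has length $n\equiv 1 \pmod 4$. A cycle decomposition of a graph is a partition of its edge set into edge sets of cycles. -}

module Defs where

open import Data.Nat as ℕ using (ℕ; _≤_; _%_)
open import Data.Nat.Divisibility using (_∣_)
open import Data.Fin as Fin using (Fin; _<?_; _≟_)
open import Data.Product using (_×_; _,_; proj₁; proj₂)
open import Data.List using (List; []; _∷_; _++_; [_]; length; zipWith; filter; concat; map)
open import Data.List.Relation.Unary.All using (All)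
open import Data.List.Relation.Unary.Unique.Propositional using (Unique)
open import Data.List.Membership.Propositional using (_∈_)
open import Data.List.Relation.Binary.Permutation.Propositional using (_↭_)
open import Relation.Binary.PropositionalEquality using (_≡_)
open import Relation.Nullary.Decidable using (yes; no; _⊎-dec_)

-- A finite simple graph on vertex set Fin n.  Each edge {u,v} is stored
-- exactly once, as the ordered pair (u , v) with u < v.
record Graph : Set where
  field
    n       : ℕ
    E       : List (Fin n × Fin n)
    ordered : All (λ e → proj₁ e Fin.< proj₂ e) E
    noDup   : Unique E
open Graph public

edgeCount : Graph → ℕ
edgeCount G = length (E G)

mkEdge : ∀ {n} → Fin n → Fin n → Fin n × Fin n
mkEdge u v with u <? v
... | yes _ = (u , v)
... | no  _ = (v , u)

Adj : (G : Graph) → Fin (n G) → Fin (n G) → Set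
Adj G u v = mkEdge u v ∈ E G

degree : (G : Graph) → Fin (n G) → ℕ
degree G v = length (filter (λ e → (proj₁ e ≟ v) ⊎-dec (proj₂ e ≟ v)) (E G))

data Walk (G : Graph) : Fin (n G) → Fin (n G) → Set where
  here : ∀ {u} → Walk G u u
  step : ∀ {u v w} → Adj G u v → Walk G v w → Walk G u w

Connected : Graph → Set
Connected G = ∀ u v → Walk G u v

IsEuler : Graph → Set
IsEuler G = Connected G × (∀ v → 2 ∣ degree G v)

rot : {A : Set} → List A → List A
rot []       = []
rot (x ∷ xs) = xs ++ [ x ]

cycleEdges : ∀ {m} → List (Fin m) → List (Fin m × Fin m)
cycleEdges vs = zipWith mkEdge vs (rot vs)

record Cycle (G : Graph) : Set where
  field
    verts    : List (Fin (n G))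
    long     : 3 ≤ length verts
    distinct : Unique verts
    closed   : All (λ e → e ∈ E G) (cycleEdges verts)
open Cycle public

cycleLength : ∀ {G} → Cycle G → ℕ
cycleLength C = length (verts C)

InE1 : Graph → Set
InE1 G = IsEuler G × (∀ (C : Cycle G) → cycleLength C % 4 ≡ 1)

IsCycleDecomposition : (G : Graph) → List (Cycle G) → Set
IsCycleDecomposition G cs = concat (map (λ C → cycleEdges (verts C)) cs) ↭ E G

-- The cycles of a decomposition partition the edge set, so q is the sum of
-- the cycle lengths; in ε₁ each length is ≡ 1 (mod 4), so the sum is ≡ ξ₁.
module Submission where

open import Defs
open import Data.Nat using (ℕ; NonZero; _+_; _%_; _⊓_)
open import Data.Nat.Properties using (+-comm; ⊓-idem)
open import Data.Nat.DivMod using (%-distribˡ-+)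
open import Data.Nat.ListAction using (sum)
open import Data.Fin using (Fin)
open import Data.List using (List; []; _∷_; length; concat; map)
open import Data.List.Properties using (length-++; length-map; length-zipWith; map-cong)
open import Data.List.Relation.Unary.All as All using (All; []; _∷_)
open import Data.List.Relation.Unary.All.Properties as All using ()
open import Data.List.Relation.Binary.Permutation.Propositional.Properties using (↭-length)
open import Data.Product using (_,_)
open import Function using (_∘_)
open import Relation.Binary.PropositionalEquality

length-rot : ∀ {A : Set} (xs : List A) → length (rot xs) ≡ length xs
length-rot []       = refl
length-rot (x ∷ xs) = trans (length-++ xs) (+-comm (length xs) 1)

length-cycleEdges : ∀ {m} (vs : List (Fin m)) → length (cycleEdges vs) ≡ length vs
length-cycleEdges vs = begin
  length (cycleEdges vs)          ≡⟨ length-zipWith mkEdge vs (rot vs) ⟩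
  length vs ⊓ length (rot vs)     ≡⟨ cong (length vs ⊓_) (length-rot vs) ⟩
  length vs ⊓ length vs           ≡⟨ ⊓-idem (length vs) ⟩
  length vs                       ∎
  where open ≡-Reasoning

length-concat-map : ∀ {A B : Set} (f : A → List B) (xs : List A) →
                    length (concat (map f xs)) ≡ sum (map (length ∘ f) xs)
length-concat-map f []       = refl
length-concat-map f (x ∷ xs) =
  trans (length-++ (f x)) (cong (length (f x) +_) (length-concat-map f xs))

sum%≡length% : ∀ d .{{_ : NonZero d}} (ns : List ℕ) →
               All (λ m → m % d ≡ 1 % d) ns → sum ns % d ≡ length ns % d
sum%≡length% d []       []         = refl
sum%≡length% d (m ∷ ns) (m≡1 ∷ ps) = begin
  (m + sum ns) % d                  ≡⟨ %-distribˡ-+ m (sum ns) d ⟩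
  (m % d + sum ns % d) % d          ≡⟨ cong₂ (λ a b → (a + b) % d) m≡1 (sum%≡length% d ns ps) ⟩
  (1 % d + length ns % d) % d       ≡⟨ %-distribˡ-+ 1 (length ns) d ⟨
  (1 + length ns) % d               ∎
  where open ≡-Reasoning

edgeCount≡sum-cycleLength : ∀ {G : Graph} (cs : List (Cycle G)) → IsCycleDecomposition G cs →
                            edgeCount G ≡ sum (map cycleLength cs)
edgeCount≡sum-cycleLength {G} cs decomposes = begin
  edgeCount G                                           ≡⟨ ↭-length decomposes ⟨
  length (concat (map (cycleEdges ∘ verts) cs))         ≡⟨ length-concat-map (cycleEdges ∘ verts) cs ⟩
  sum (map (length ∘ cycleEdges ∘ verts) cs)            ≡⟨ cong sum (map-cong (length-cycleEdges ∘ verts) cs) ⟩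
  sum (map cycleLength cs)                              ∎
  where open ≡-Reasoning

theorem9 : (G : Graph) → InE1 G → (cs : List (Cycle G)) → IsCycleDecomposition G cs →
    edgeCount G % 4 ≡ length cs % 4
theorem9 G (_ , lengths≡1) cs decomposes = begin
  edgeCount G % 4                      ≡⟨ cong (_% 4) (edgeCount≡sum-cycleLength cs decomposes) ⟩
  sum (map cycleLength cs) % 4         ≡⟨ sum%≡length% 4 (map cycleLength cs)
                                            (All.map⁺ (All.universal lengths≡1 cs)) ⟩
  length (map cycleLength cs) % 4      ≡⟨ cong (_% 4) (length-map cycleLength cs) ⟩
  length cs % 4                        ∎
  where open ≡-Reasoning
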